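{- Let $0\le r\le n/2$, let $B=\bigcup_{i=0}^r S(n,i)$ be the Hamming ball of radius $r$ around $0$ in $\{0,1\}^n$, and let $A$ be the adjacency matrix of the subgraph of the Hamming cube induced by $B$. For $y\in B$, the space $S^{(B)}_y$ of functions semi-symmetric around $y$ on $B$ is an invariant subspace of $A$.
   Context: The Hamming cube graph on $\{0,1\}^n$ has edges between points at Hamming distance $1$; $|x|$ is Hamming weight and $|x-y|$ Hamming distance; $S(n,i)=\{x:|x|=i\}$. $S^{(B)}_y$ is the space of real functions $f$ on $B$ such that $f(x)$ depends only on the pair $(|x|,|x-y|)$. -}

module Defs where

open import Level using (Level)
open import Data.Bool using (Bool; true; false; if_then_else_; _xor_)
open import Data.Nat using (ℕ; zero; suc; _≤_; _≤?_; _≡ᵇ_)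
open import Data.Vec using (Vec; []; _∷_; zipWith)
open import Data.List using (List; []; _∷_; map; _++_; filter)
open import Relation.Binary.PropositionalEquality using (_≡_)
open import Algebra.Bundles using (CommutativeRing)

Point : ℕ → Set
Point n = Vec Bool n

weight : ∀ {n} → Point n → ℕ
weight [] = zero
weight (true ∷ x) = suc (weight x)
weight (false ∷ x) = weight x

dist : ∀ {n} → Point n → Point n → ℕ
dist x y = weight (zipWith _xor_ x y)

allPoints : (n : ℕ) → List (Point n)
allPoints zero = [] ∷ []
allPoints (suc n) = map (false ∷_) (allPoints n) ++ map (true ∷_) (allPoints n)

InBall : ∀ {n} → ℕ → Point n → Set
InBall r x = weight x ≤ r

ballPoints : (n r : ℕ) → List (Point n)
ballPoints n r = filter (λ z → weight z ≤? r) (allPoints n)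

module _ {c ℓ : Level} (R : CommutativeRing c ℓ) where
  open CommutativeRing R

  sumR : List Carrier → Carrier
  sumR [] = 0#
  sumR (a ∷ as) = a + sumR as

  adj : ∀ {n} → Point n → Point n → Carrier
  adj x z = if dist x z ≡ᵇ 1 then 1# else 0#

  -- Action of the adjacency matrix A of the subgraph induced by B on a
  -- function f on B (represented as a function on the cube; only its
  -- values on B are used):  (A f)(x) = Σ_{z ∈ B} A_{xz} f(z).
  adjAct : (n r : ℕ) → (Point n → Carrier) → (Point n → Carrier)
  adjAct n r f x = sumR (map (λ z → adj x z * f z) (ballPoints n r))

  SemiSym : (n r : ℕ) → Point n → (Point n → Carrier) → Set ℓ
  SemiSym n r y f = ∀ (x x' : Point n) → InBall r x → InBall r x' →
    weight x ≡ weight x' → dist x y ≡ dist x' y → f x ≈ f x'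

{-# OPTIONS --safe #-}
module Submission where

-- Extend f from B to the whole cube by zero. Then (A f)(x) is the sum of the extension over the
-- n neighbours of x. Flipping the i-th coordinate of x moves (|x|, |x - y|) by a step that depends
-- only on the kind (x_i, y_i) of the coordinate, so the extension is constant on each of the four
-- groups of neighbours of a given kind; and the sizes of the groups, the numbers of coordinates of
-- each kind, are determined by |x|, |y|, |x - y| and n. Hence (A f)(x) depends only on
-- (|x|, |x - y|).

open import Defs
open import Level using (Level)
open import Data.Nat using (ℕ; _≤_; _*_)
open import Algebra.Bundles using (CommutativeRing)

open import Algebra.Properties.CommutativeSemigroup using (interchange)
open import Data.Bool using (Bool; true; false; not; _xor_; if_then_else_)
open import Data.Bool.Properties using (_≟_)
open import Data.List using (List; []; _∷_; map; _++_; filter; length)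
open import Data.List.Properties using (length-map)
open import Data.List.Relation.Unary.All as All using (All; []; _∷_)
open import Data.List.Relation.Unary.All.Properties using (map⁺)
open import Data.Nat using (zero; suc; _≤?_; _≡ᵇ_)
open import Data.Nat.Properties using (suc-injective)
open import Data.Product using (_×_; _,_)
open import Data.Product.Properties using (≡-dec)
open import Data.Vec using ([]; _∷_)
open import Relation.Binary.Definitions using (DecidableEquality)
open import Relation.Binary.PropositionalEquality as ≡ using (_≡_; cong; cong₂; subst)
open import Relation.Nullary using (Dec; does; yes; no; contradiction)
open import Relation.Unary using (Decidable)
import Relation.Binary.Reasoning.Setoid as SetoidReasoning

neighbours : ∀ {n} → Point n → List (Point n)
neighbours [] = []
neighbours (b ∷ x) = (not b ∷ x) ∷ map (b ∷_) (neighbours x)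

-- The kind of coordinate i with respect to the pair (x, y) is (x_i, y_i).
Kind : Set
Kind = Bool × Bool

_≟ᵏ_ : DecidableEquality Kind
_≟ᵏ_ = ≡-dec _≟_ _≟_

kinds : List Kind
kinds = (true , true) ∷ (true , false) ∷ (false , true) ∷ (false , false) ∷ []

flipsOfKind : ∀ {n} → Kind → Point n → Point n → List (Point n)
flipsOfKind κ [] [] = []
flipsOfKind κ (x₀ ∷ x) (y₀ ∷ y) with κ ≟ᵏ (x₀ , y₀)
... | yes _ = (not x₀ ∷ x) ∷ map (x₀ ∷_) (flipsOfKind κ x y)
... | no _ = map (x₀ ∷_) (flipsOfKind κ x y)

count : ∀ {n} → Kind → Point n → Point n → ℕ
count κ [] [] = 0
count κ (x₀ ∷ x) (y₀ ∷ y) with κ ≟ᵏ (x₀ , y₀)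
... | yes _ = suc (count κ x y)
... | no _ = count κ x y

length-flipsOfKind : ∀ {n} κ (x y : Point n) → length (flipsOfKind κ x y) ≡ count κ x y
length-flipsOfKind κ [] [] = ≡.refl
length-flipsOfKind κ (x₀ ∷ x) (y₀ ∷ y) with κ ≟ᵏ (x₀ , y₀)
... | yes _ = cong suc (≡.trans (length-map _ (flipsOfKind κ x y)) (length-flipsOfKind κ x y))
... | no _ = ≡.trans (length-map _ (flipsOfKind κ x y)) (length-flipsOfKind κ x y)

record SameProfile {n} (y p p′ : Point n) : Set where
  constructor _,_
  field
    weight≡ : weight p ≡ weight p′
    dist≡ : dist p y ≡ dist p′ y

-- A separate scope, so that the _+_ of ℕ does not clash with the ring addition in CubeSums.
module _ where
  open import Data.Nat using (_+_)
  open import Data.Nat.Properties using (+-suc; +-cancelˡ-≡; +-cancelʳ-≡; *-cancelˡ-≡)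
  open import Data.Nat.Tactic.RingSolver using (solve-∀)

  count-weightˡ : ∀ {n} (x y : Point n) → count (true , true) x y + count (true , false) x y ≡ weight x
  count-weightˡ [] [] = ≡.refl
  count-weightˡ (true ∷ x) (true ∷ y) = cong suc (count-weightˡ x y)
  count-weightˡ (true ∷ x) (false ∷ y) = ≡.trans (+-suc _ _) (cong suc (count-weightˡ x y))
  count-weightˡ (false ∷ x) (true ∷ y) = count-weightˡ x y
  count-weightˡ (false ∷ x) (false ∷ y) = count-weightˡ x y

  count-weightʳ : ∀ {n} (x y : Point n) → count (true , true) x y + count (false , true) x y ≡ weight y
  count-weightʳ [] [] = ≡.refl
  count-weightʳ (true ∷ x) (true ∷ y) = cong suc (count-weightʳ x y)
  count-weightʳ (true ∷ x) (false ∷ y) = count-weightʳ x y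
  count-weightʳ (false ∷ x) (true ∷ y) = ≡.trans (+-suc _ _) (cong suc (count-weightʳ x y))
  count-weightʳ (false ∷ x) (false ∷ y) = count-weightʳ x y

  count-dist : ∀ {n} (x y : Point n) → count (true , false) x y + count (false , true) x y ≡ dist x y
  count-dist [] [] = ≡.refl
  count-dist (true ∷ x) (true ∷ y) = count-dist x y
  count-dist (true ∷ x) (false ∷ y) = cong suc (count-dist x y)
  count-dist (false ∷ x) (true ∷ y) = ≡.trans (+-suc _ _) (cong suc (count-dist x y))
  count-dist (false ∷ x) (false ∷ y) = count-dist x y

  count-total : ∀ {n} (x y : Point n) →
    count (true , true) x y + count (true , false) x y + count (false , true) x y + count (false , false) x y ≡ n
  count-total [] [] = ≡.refl
  count-total (true ∷ x) (true ∷ y) = cong suc (count-total x y)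
  count-total (true ∷ x) (false ∷ y) =
    ≡.trans (cong (λ m → m + count (false , true) x y + count (false , false) x y) (+-suc (count (true , true) x y) _))
      (cong suc (count-total x y))
  count-total (false ∷ x) (true ∷ y) =
    ≡.trans (cong (_+ count (false , false) x y) (+-suc (count (true , true) x y + count (true , false) x y) _))
      (cong suc (count-total x y))
  count-total (false ∷ x) (false ∷ y) = ≡.trans (+-suc _ _) (cong suc (count-total x y))

  pairwise-sums-determine : ∀ {a b c a′ b′ c′} →
    a + b ≡ a′ + b′ → a + c ≡ a′ + c′ → b + c ≡ b′ + c′ → a ≡ a′
  pairwise-sums-determine {a} {b} {c} {a′} {b′} {c′} ab ac bc =
    *-cancelˡ-≡ a a′ 2 (+-cancelʳ-≡ (b + c) (2 * a) (2 * a′) (begin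
      2 * a + (b + c)         ≡⟨ regroup a b c ⟩
      (a + b) + (a + c)       ≡⟨ cong₂ _+_ ab ac ⟩
      (a′ + b′) + (a′ + c′)   ≡⟨ ≡.sym (regroup a′ b′ c′) ⟩
      2 * a′ + (b′ + c′)      ≡⟨ cong (2 * a′ +_) (≡.sym bc) ⟩
      2 * a′ + (b + c)        ∎))
    where
    open ≡.≡-Reasoning
    regroup : ∀ a b c → 2 * a + (b + c) ≡ (a + b) + (a + c)
    regroup = solve-∀

  module _ {n} {x x′ y : Point n} (same : SameProfile y x x′) where
    private
      cTT cTF cFT cFF : Point n → Point n → ℕ
      cTT = count (true , true)
      cTF = count (true , false)
      cFT = count (false , true)
      cFF = count (false , false)

      weightˡ : cTT x y + cTF x y ≡ cTT x′ y + cTF x′ y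
      weightˡ = ≡.trans (count-weightˡ x y) (≡.trans (SameProfile.weight≡ same) (≡.sym (count-weightˡ x′ y)))

      weightʳ : cTT x y + cFT x y ≡ cTT x′ y + cFT x′ y
      weightʳ = ≡.trans (count-weightʳ x y) (≡.sym (count-weightʳ x′ y))

      distance : cTF x y + cFT x y ≡ cTF x′ y + cFT x′ y
      distance = ≡.trans (count-dist x y) (≡.trans (SameProfile.dist≡ same) (≡.sym (count-dist x′ y)))

      total : cTT x y + cTF x y + cFT x y + cFF x y ≡ cTT x′ y + cTF x′ y + cFT x′ y + cFF x′ y
      total = ≡.trans (count-total x y) (≡.sym (count-total x′ y))

      TT : cTT x y ≡ cTT x′ y
      TT = pairwise-sums-determine weightˡ weightʳ distance

      TF : cTF x y ≡ cTF x′ y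
      TF = +-cancelˡ-≡ (cTT x y) _ _ (≡.trans weightˡ (cong (_+ cTF x′ y) (≡.sym TT)))

      FT : cFT x y ≡ cFT x′ y
      FT = +-cancelˡ-≡ (cTT x y) _ _ (≡.trans weightʳ (cong (_+ cFT x′ y) (≡.sym TT)))

      FF : cFF x y ≡ cFF x′ y
      FF = +-cancelˡ-≡ (cTT x y + cTF x y + cFT x y) _ _
        (≡.trans total (cong (_+ cFF x′ y) (≡.sym (cong₂ _+_ (cong₂ _+_ TT TF) FT))))

    count-cong : ∀ κ → count κ x y ≡ count κ x′ y
    count-cong (true , true) = TT
    count-cong (true , false) = TF
    count-cong (false , true) = FT
    count-cong (false , false) = FF

data Step : Bool → ℕ → ℕ → Set where
  down : ∀ {m} → Step true (suc m) m
  up : ∀ {m} → Step false m (suc m)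

Step-functional : ∀ {s m a b} → Step s m a → Step s m b → a ≡ b
Step-functional down down = ≡.refl
Step-functional up up = ≡.refl

Step-suc : ∀ {s m m′} → Step s m m′ → Step s (suc m) (suc m′)
Step-suc down = down
Step-suc up = up

Step-weight-∷ : ∀ {n s} z {u v : Point n} →
  Step s (weight u) (weight v) → Step s (weight (z ∷ u)) (weight (z ∷ v))
Step-weight-∷ true = Step-suc
Step-weight-∷ false step = step

-- Flipping a coordinate of kind (b , c) lowers |x| iff b, and lowers |x - y| iff b ≠ c.
FlipProfile : ∀ {n} → Kind → Point n → Point n → Point n → Set
FlipProfile (b , c) y x p = Step b (weight x) (weight p) × Step (b xor c) (dist x y) (dist p y)

FlipProfile-head : ∀ {n} x₀ y₀ (x y : Point n) → FlipProfile (x₀ , y₀) (y₀ ∷ y) (x₀ ∷ x) (not x₀ ∷ x)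
FlipProfile-head true true x y = down , up
FlipProfile-head true false x y = down , down
FlipProfile-head false true x y = up , down
FlipProfile-head false false x y = up , up

FlipProfile-∷ : ∀ {n} κ x₀ y₀ {x y p : Point n} →
  FlipProfile κ y x p → FlipProfile κ (y₀ ∷ y) (x₀ ∷ x) (x₀ ∷ p)
FlipProfile-∷ (b , c) x₀ y₀ (stepʷ , stepᵈ) = Step-weight-∷ x₀ stepʷ , Step-weight-∷ (x₀ xor y₀) stepᵈ

flipsOfKind-profile : ∀ {n} κ (x y : Point n) → All (FlipProfile κ y x) (flipsOfKind κ x y)
flipsOfKind-profile κ [] [] = []
flipsOfKind-profile κ (x₀ ∷ x) (y₀ ∷ y) with κ ≟ᵏ (x₀ , y₀)
... | yes ≡.refl =
  FlipProfile-head x₀ y₀ x y ∷ map⁺ (All.map (FlipProfile-∷ κ x₀ y₀) (flipsOfKind-profile κ x y))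
... | no _ = map⁺ (All.map (FlipProfile-∷ κ x₀ y₀) (flipsOfKind-profile κ x y))

FlipProfile-functional : ∀ {n} κ {x x′ y p p′ : Point n} → SameProfile y x x′ →
  FlipProfile κ y x p → FlipProfile κ y x′ p′ → SameProfile y p p′
FlipProfile-functional (b , c) {p = p} {p′} (ew , ed) (stepʷ , stepᵈ) (stepʷ′ , stepᵈ′) =
  Step-functional (subst (λ m → Step b m (weight p)) ew stepʷ) stepʷ′ ,
  Step-functional (subst (λ m → Step (b xor c) m (dist p _)) ed stepᵈ) stepᵈ′

module CubeSums {c ℓ : Level} (R : CommutativeRing c ℓ) where
  open CommutativeRing R renaming (_*_ to _·_)
  open SetoidReasoning setoid

  sumOver : {A : Set} → List A → (A → Carrier) → Carrier
  sumOver l k = sumR R (map k l)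

  sumOver-cong : {A : Set} (l : List A) {k k′ : A → Carrier} →
    (∀ a → k a ≈ k′ a) → sumOver l k ≈ sumOver l k′
  sumOver-cong [] k≈k′ = refl
  sumOver-cong (a ∷ l) k≈k′ = +-cong (k≈k′ a) (sumOver-cong l k≈k′)

  sumOver-map : {A B : Set} (g : A → B) (l : List A) {k : B → Carrier} →
    sumOver (map g l) k ≈ sumOver l (λ a → k (g a))
  sumOver-map g [] = refl
  sumOver-map g (a ∷ l) = +-congˡ (sumOver-map g l)

  sumOver-++ : {A : Set} (l l′ : List A) {k : A → Carrier} → sumOver (l ++ l′) k ≈ sumOver l k + sumOver l′ k
  sumOver-++ [] l′ = sym (+-identityˡ _)
  sumOver-++ (a ∷ l) l′ = trans (+-congˡ (sumOver-++ l l′)) (sym (+-assoc _ _ _))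

  sumOver-+ : {A : Set} (l : List A) (g h : A → Carrier) →
    sumOver l (λ a → g a + h a) ≈ sumOver l g + sumOver l h
  sumOver-+ [] g h = sym (+-identityˡ 0#)
  sumOver-+ (a ∷ l) g h = trans (+-congˡ (sumOver-+ l g h)) (interchange +-commutativeSemigroup _ _ _ _)

  sumOver-zeroˡ : {A : Set} (l : List A) {k : A → Carrier} → sumOver l (λ a → 0# · k a) ≈ 0#
  sumOver-zeroˡ [] = refl
  sumOver-zeroˡ (a ∷ l) = trans (+-cong (zeroˡ _) (sumOver-zeroˡ l)) (+-identityˡ 0#)

  sumOver-filter : {A : Set} {P : A → Set} (P? : Decidable P) (l : List A) {k : A → Carrier} →
    sumOver (filter P? l) k ≈ sumOver l (λ a → if does (P? a) then k a else 0#)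
  sumOver-filter P? [] = refl
  sumOver-filter P? (a ∷ l) with does (P? a)
  ... | true = +-congˡ (sumOver-filter P? l)
  ... | false = trans (sumOver-filter P? l) (sym (+-identityˡ _))

  sumOver-uniform-cong : {A : Set} {P Q : A → Set} {k : A → Carrier} (l l′ : List A) →
    length l ≡ length l′ → All P l → All Q l′ → (∀ {a a′} → P a → Q a′ → k a ≈ k a′) →
    sumOver l k ≈ sumOver l′ k
  sumOver-uniform-cong [] [] _ _ _ _ = refl
  sumOver-uniform-cong (a ∷ l) (a′ ∷ l′) eq (pa ∷ pl) (qa′ ∷ ql′) k≈ =
    +-cong (k≈ pa qa′) (sumOver-uniform-cong l l′ (suc-injective eq) pl ql′ k≈)

  sumOver-kinds-indicator : ∀ κ₀ (e : Carrier) →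
    sumOver kinds (λ κ → if does (κ ≟ᵏ κ₀) then e else 0#) ≈ e
  sumOver-kinds-indicator (true , true) e =
    trans (+-congˡ (trans (+-identityˡ _) (trans (+-identityˡ _) (+-identityˡ _)))) (+-identityʳ e)
  sumOver-kinds-indicator (true , false) e =
    trans (+-identityˡ _) (trans (+-congˡ (trans (+-identityˡ _) (+-identityˡ _))) (+-identityʳ e))
  sumOver-kinds-indicator (false , true) e =
    trans (+-identityˡ _) (trans (+-identityˡ _) (trans (+-congˡ (+-identityˡ _)) (+-identityʳ e)))
  sumOver-kinds-indicator (false , false) e =
    trans (+-identityˡ _) (trans (+-identityˡ _) (trans (+-identityˡ _) (+-identityʳ e)))

  sumOver-allPoints-suc : ∀ n {k : Point (suc n) → Carrier} →
    sumOver (allPoints (suc n)) k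
      ≈ sumOver (allPoints n) (λ z → k (false ∷ z)) + sumOver (allPoints n) (λ z → k (true ∷ z))
  sumOver-allPoints-suc n = trans (sumOver-++ (map (false ∷_) (allPoints n)) _)
    (+-cong (sumOver-map (false ∷_) (allPoints n)) (sumOver-map (true ∷_) (allPoints n)))

  -- Phrased through dist so that adj R (b ∷ x) (not b ∷ z) unfolds to δ x z.
  δ : ∀ {n} → Point n → Point n → Carrier
  δ x z = if dist x z ≡ᵇ 0 then 1# else 0#

  sumOver-δ : ∀ n (x : Point n) (k : Point n → Carrier) → sumOver (allPoints n) (λ z → δ x z · k z) ≈ k x
  sumOver-δ zero [] k = trans (+-identityʳ _) (*-identityˡ _)
  sumOver-δ (suc n) (false ∷ x) k = trans (sumOver-allPoints-suc n)
    (trans (+-cong (sumOver-δ n x _) (sumOver-zeroˡ (allPoints n))) (+-identityʳ _))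
  sumOver-δ (suc n) (true ∷ x) k = trans (sumOver-allPoints-suc n)
    (trans (+-cong (sumOver-zeroˡ (allPoints n)) (sumOver-δ n x _)) (+-identityˡ _))

  sumOver-adj : ∀ n (x : Point n) (k : Point n → Carrier) →
    sumOver (allPoints n) (λ z → adj R x z · k z) ≈ sumOver (neighbours x) k
  sumOver-adj zero [] k = trans (+-identityʳ _) (zeroˡ _)
  sumOver-adj (suc n) (false ∷ x) k = begin
    sumOver (allPoints (suc n)) (λ z → adj R (false ∷ x) z · k z)
      ≈⟨ sumOver-allPoints-suc n ⟩
    sumOver (allPoints n) (λ z → adj R x z · k (false ∷ z)) + sumOver (allPoints n) (λ z → δ x z · k (true ∷ z))
      ≈⟨ +-cong (sumOver-adj n x _) (sumOver-δ n x _) ⟩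
    sumOver (neighbours x) (λ z → k (false ∷ z)) + k (true ∷ x)
      ≈⟨ +-comm _ _ ⟩
    k (true ∷ x) + sumOver (neighbours x) (λ z → k (false ∷ z))
      ≈⟨ +-congˡ (sym (sumOver-map (false ∷_) (neighbours x))) ⟩
    sumOver (neighbours (false ∷ x)) k ∎
  sumOver-adj (suc n) (true ∷ x) k = begin
    sumOver (allPoints (suc n)) (λ z → adj R (true ∷ x) z · k z)
      ≈⟨ sumOver-allPoints-suc n ⟩
    sumOver (allPoints n) (λ z → δ x z · k (false ∷ z)) + sumOver (allPoints n) (λ z → adj R x z · k (true ∷ z))
      ≈⟨ +-cong (sumOver-δ n x _) (sumOver-adj n x _) ⟩
    k (false ∷ x) + sumOver (neighbours x) (λ z → k (true ∷ z))
      ≈⟨ +-congˡ (sym (sumOver-map (true ∷_) (neighbours x))) ⟩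
    sumOver (neighbours (true ∷ x)) k ∎

  sumOver-flipsOfKind-∷ : ∀ {n} κ x₀ y₀ (x y : Point n) (k : Point (suc n) → Carrier) →
    sumOver (flipsOfKind κ (x₀ ∷ x) (y₀ ∷ y)) k
      ≈ (if does (κ ≟ᵏ (x₀ , y₀)) then k (not x₀ ∷ x) else 0#)
        + sumOver (flipsOfKind κ x y) (λ z → k (x₀ ∷ z))
  sumOver-flipsOfKind-∷ κ x₀ y₀ x y k with κ ≟ᵏ (x₀ , y₀)
  ... | yes _ = +-congˡ (sumOver-map (x₀ ∷_) (flipsOfKind κ x y))
  ... | no _ = trans (sumOver-map (x₀ ∷_) (flipsOfKind κ x y)) (sym (+-identityˡ _))

  sumOver-neighbours-by-kind : ∀ {n} (x y : Point n) (k : Point n → Carrier) →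
    sumOver (neighbours x) k ≈ sumOver kinds (λ κ → sumOver (flipsOfKind κ x y) k)
  sumOver-neighbours-by-kind [] [] k =
    sym (trans (+-identityˡ _) (trans (+-identityˡ _) (trans (+-identityˡ _) (+-identityˡ _))))
  sumOver-neighbours-by-kind (x₀ ∷ x) (y₀ ∷ y) k = begin
    k (not x₀ ∷ x) + sumOver (map (x₀ ∷_) (neighbours x)) k
      ≈⟨ +-congˡ (trans (sumOver-map (x₀ ∷_) (neighbours x)) (sumOver-neighbours-by-kind x y _)) ⟩
    k (not x₀ ∷ x) + sumOver kinds atTail
      ≈⟨ +-congʳ (sym (sumOver-kinds-indicator (x₀ , y₀) _)) ⟩
    sumOver kinds atHead + sumOver kinds atTail
      ≈⟨ sym (sumOver-+ kinds atHead atTail) ⟩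
    sumOver kinds (λ κ → atHead κ + atTail κ)
      ≈⟨ sumOver-cong kinds (λ κ → sym (sumOver-flipsOfKind-∷ κ x₀ y₀ x y k)) ⟩
    sumOver kinds (λ κ → sumOver (flipsOfKind κ (x₀ ∷ x) (y₀ ∷ y)) k) ∎
    where
    atHead atTail : Kind → Carrier
    atHead κ = if does (κ ≟ᵏ (x₀ , y₀)) then k (not x₀ ∷ x) else 0#
    atTail κ = sumOver (flipsOfKind κ x y) (λ z → k (x₀ ∷ z))

  ProfileInvariant : ∀ {n} → Point n → (Point n → Carrier) → Set ℓ
  ProfileInvariant y k = ∀ {p p′} → SameProfile y p p′ → k p ≈ k p′

  sumOver-flipsOfKind-cong : ∀ {n} {x x′ y : Point n} {k : Point n → Carrier} → ProfileInvariant y k →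
    SameProfile y x x′ → ∀ κ → sumOver (flipsOfKind κ x y) k ≈ sumOver (flipsOfKind κ x′ y) k
  sumOver-flipsOfKind-cong {x = x} {x′} {y} invariant same κ = sumOver-uniform-cong _ _
    (≡.trans (length-flipsOfKind κ x y) (≡.trans (count-cong same κ) (≡.sym (length-flipsOfKind κ x′ y))))
    (flipsOfKind-profile κ x y) (flipsOfKind-profile κ x′ y)
    (λ profile profile′ → invariant (FlipProfile-functional κ same profile profile′))

  sumOver-neighbours-cong : ∀ {n} {x x′ y : Point n} {k : Point n → Carrier} → ProfileInvariant y k →
    SameProfile y x x′ → sumOver (neighbours x) k ≈ sumOver (neighbours x′) k
  sumOver-neighbours-cong {x = x} {x′} {y} {k} invariant same = begin
    sumOver (neighbours x) k
      ≈⟨ sumOver-neighbours-by-kind x y k ⟩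
    sumOver kinds (λ κ → sumOver (flipsOfKind κ x y) k)
      ≈⟨ sumOver-cong kinds (sumOver-flipsOfKind-cong invariant same) ⟩
    sumOver kinds (λ κ → sumOver (flipsOfKind κ x′ y) k)
      ≈⟨ sym (sumOver-neighbours-by-kind x′ y k) ⟩
    sumOver (neighbours x′) k ∎

  restrictToBall : ∀ {n} → ℕ → (Point n → Carrier) → Point n → Carrier
  restrictToBall r f z = if does (weight z ≤? r) then f z else 0#

  restrictToBall-invariant : ∀ {n r y f} → SemiSym R n r y f → ProfileInvariant y (restrictToBall r f)
  restrictToBall-invariant {r = r} {f = f} semiSym {p} {p′} (ew , ed) = byMembership (weight p ≤? r) (weight p′ ≤? r)
    where
    byMembership : (p∈B? : Dec (weight p ≤ r)) (p′∈B? : Dec (weight p′ ≤ r)) →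
      (if does p∈B? then f p else 0#) ≈ (if does p′∈B? then f p′ else 0#)
    byMembership (yes p∈B) (yes p′∈B) = semiSym p p′ p∈B p′∈B ew ed
    byMembership (no _) (no _) = refl
    byMembership (yes p∈B) (no p′∉B) = contradiction (subst (_≤ r) ew p∈B) p′∉B
    byMembership (no p∉B) (yes p′∈B) = contradiction (subst (_≤ r) (≡.sym ew) p′∈B) p∉B

  adjAct≈sumOver-neighbours : ∀ n r f (x : Point n) → adjAct R n r f x ≈ sumOver (neighbours x) (restrictToBall r f)
  adjAct≈sumOver-neighbours n r f x = begin
    adjAct R n r f x
      ≈⟨ sumOver-filter (λ z → weight z ≤? r) (allPoints n) ⟩
    sumOver (allPoints n) (λ z → if does (weight z ≤? r) then adj R x z · f z else 0#)
      ≈⟨ sumOver-cong (allPoints n) (λ z → if-·-zero (does (weight z ≤? r))) ⟩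
    sumOver (allPoints n) (λ z → adj R x z · restrictToBall r f z)
      ≈⟨ sumOver-adj n x (restrictToBall r f) ⟩
    sumOver (neighbours x) (restrictToBall r f) ∎
    where
    if-·-zero : ∀ {a b} m → (if m then a · b else 0#) ≈ a · (if m then b else 0#)
    if-·-zero true = refl
    if-·-zero false = sym (zeroʳ _)

lemma2p1 : ∀ {c ℓ : Level} (R : CommutativeRing c ℓ) (n r : ℕ) → 2 * r ≤ n →
    (y : Point n) → InBall r y →
    (f : Point n → CommutativeRing.Carrier R) → SemiSym R n r y f →
    SemiSym R n r y (adjAct R n r f)
lemma2p1 R n r _ y _ f semiSym x x′ _ _ ew ed = begin
  adjAct R n r f x
    ≈⟨ adjAct≈sumOver-neighbours n r f x ⟩
  sumOver (neighbours x) (restrictToBall r f)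
    ≈⟨ sumOver-neighbours-cong {x = x} {x′} (restrictToBall-invariant semiSym) (ew , ed) ⟩
  sumOver (neighbours x′) (restrictToBall r f)
    ≈⟨ sym (adjAct≈sumOver-neighbours n r f x′) ⟩
  adjAct R n r f x′ ∎
  where
  open CubeSums R
  open CommutativeRing R using (sym)
  open SetoidReasoning (CommutativeRing.setoid R)
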